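{- For every $n\ge0$, the number $c_n$ of compacted binary trees of size $n$ satisfies $$ n!\le c_n\le \frac{1}{n+1}\binom{2n}{n}\, n!. $$
   Context: A full binary tree is a rooted plane tree in which every node has $0$ or $2$ ordered children; a fringe subtree is a node with all its descendants. A compacted binary tree is the DAG obtained from a full binary tree by post-order traversal, replacing each edge leading to a fringe subtree identical to one already seen by a pointer to its first occurrence. Its size is its number of internal nodes, i.e. the number of distinct non-leaf fringe subtrees of the original tree; $c_n$ equals the number of full binary trees with exactly $n$ distinct non-leaf fringe subtrees. -}

module Defs where

open import Data.Nat using (ℕ; suc; _*_; _/_)
open import Data.Nat.Combinatorics using (_C_)
open import Data.List using (List; []; _∷_; _++_; length; deduplicate)
open import Relation.Binary.PropositionalEquality using (_≡_; refl; cong₂)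
open import Relation.Nullary using (Dec; yes; no)

data Tree : Set where
  leaf : Tree
  node : Tree → Tree → Tree

node-injˡ : ∀ {a b c d} → node a b ≡ node c d → a ≡ c
node-injˡ refl = refl

node-injʳ : ∀ {a b c d} → node a b ≡ node c d → b ≡ d
node-injʳ refl = refl

_≟T_ : (s t : Tree) → Dec (s ≡ t)
leaf ≟T leaf = yes refl
leaf ≟T node _ _ = no (λ ())
node _ _ ≟T leaf = no (λ ())
node a b ≟T node c d with a ≟T c | b ≟T d
... | yes p | yes q = yes (cong₂ node p q)
... | no ¬p | _ = no (λ e → ¬p (node-injˡ e))
... | yes _ | no ¬q = no (λ e → ¬q (node-injʳ e))

internalFringe : Tree → List Tree
internalFringe leaf = []
internalFringe (node l r) = node l r ∷ (internalFringe l ++ internalFringe r)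

-- Size of the compacted tree of t: number of distinct non-leaf fringe subtrees.
compactedSize : Tree → ℕ
compactedSize t = length (deduplicate _≟T_ (internalFringe t))

-- Catalan number  (1/(n+1)) * binom(2n, n)  (the division is exact).
catalan : ℕ → ℕ
catalan n = ((2 * n) C n) / suc n

-- Lower bound: the "combs" t = node x t′, where x is a leaf or a node of the right
-- spine of t′, have exactly their right spine as non-leaf fringe subtrees; building
-- such a tree with k internal nodes involves k! independent choices.
--
-- Upper bound: a tree is determined by the post-order traversal of its compacted
-- tree, a word of n+1 atoms and n merges. Its shape (which steps are atoms) is a
-- ballot sequence, counted by the Catalan number; each atom is a leaf or a pointer
-- to one of the nodes built before it, and the i-th atom after the first has at
-- most i such choices, giving at most n! labellings per shape.

module Submission where

open import Defs
open import Algebra.Properties.CommutativeSemigroup using (interchange)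
open import Data.Nat
  using (ℕ; zero; suc; _+_; _*_; _∸_; _≤_; _!; _/_; z≤n; s≤s; _≟_)
open import Data.Nat.Combinatorics
  using (_C_; nCk≡nC[n∸k]; nCk≡n!/k![n-k]!; k![n∸k]!∣n!; nCk+nC[k+1]≡[n+1]C[k+1])
open import Data.Nat.DivMod using (m/n*n≡m; m*n/n≡m)
open import Data.Nat.Properties
open import Data.Nat.Tactic.RingSolver using (solve-∀)
open import Data.Product using (Σ; _×_; _,_; proj₂; ∃)
open import Data.Sum using (inj₁; inj₂)
open import Data.Vec using (Vec; []; _∷_)
open import Data.List
  using (List; []; _∷_; _++_; length; map; concatMap; filter; deduplicate)
open import Data.List.Properties using (length-++; length-map; ++-assoc; ++-identityʳ; length-filter)
open import Data.List.Membership.Propositional using (_∈_; _∉_; find)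
open import Data.List.Membership.Propositional.Properties
  using (∈-∃++; ∈-++⁺ˡ; ∈-++⁺ʳ; ∈-++⁻; ∈-map⁻; ∈-concatMap⁺; ∈-concatMap⁻;
         ∈-filter⁺; ∈-filter⁻; ∈-deduplicate⁺; ∈-deduplicate⁻)
open import Data.List.Membership.DecPropositional _≟T_ using (_∈?_)
open import Data.List.Relation.Binary.Subset.Propositional using (_⊆_)
open import Data.List.Relation.Unary.Any as Any using (here; there)
open import Data.List.Relation.Unary.All using ([])
open import Data.List.Relation.Unary.All.Properties using (¬Any⇒All¬)
open import Data.List.Relation.Unary.Unique.Propositional using (Unique; []; _∷_)
open import Data.List.Relation.Unary.Unique.Propositional.Properties
  using (Unique[x∷xs]⇒x∉xs; ++⁺; map⁺)
open import Data.List.Relation.Unary.Unique.DecPropositional.Properties _≟T_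
  using (deduplicate-!)
open import Function.Base using (_∘_)
open import Function.Bundles using (_⇔_; mk⇔)
open import Relation.Binary.PropositionalEquality
open import Relation.Nullary using (yes; no; ¬_; contradiction)

module _ {a} {A : Set a} where

  Unique∧⊆⇒length≤ : ∀ {xs ys : List A} → Unique xs → xs ⊆ ys → length xs ≤ length ys
  Unique∧⊆⇒length≤ {[]} _ _ = z≤n
  Unique∧⊆⇒length≤ {x ∷ xs} x∷xs!@(_ ∷ xs!) x∷xs⊆ys with ∈-∃++ (x∷xs⊆ys (here refl))
  ... | us , vs , refl = begin
    suc (length xs)             ≤⟨ s≤s (Unique∧⊆⇒length≤ xs! xs⊆us++vs) ⟩
    suc (length (us ++ vs))     ≡⟨ cong suc (length-++ us) ⟩
    suc (length us + length vs) ≡⟨ +-suc (length us) (length vs) ⟨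
    length us + length (x ∷ vs) ≡⟨ length-++ us ⟨
    length (us ++ x ∷ vs)       ∎
    where
      open ≤-Reasoning
      xs⊆us++vs : xs ⊆ us ++ vs
      xs⊆us++vs z∈xs with ∈-++⁻ us (x∷xs⊆ys (there z∈xs))
      ... | inj₁ z∈us = ∈-++⁺ˡ z∈us
      ... | inj₂ (here refl) = contradiction z∈xs (Unique[x∷xs]⇒x∉xs x∷xs!)
      ... | inj₂ (there z∈vs) = ∈-++⁺ʳ us z∈vs

module _ {a b} {A : Set a} {B : Set b} where

  length-concatMap-≤ : ∀ (f : A → List B) xs {k} → (∀ x → length (f x) ≤ k) →
                       length (concatMap f xs) ≤ length xs * k
  length-concatMap-≤ f [] _ = z≤n
  length-concatMap-≤ f (x ∷ xs) {k} f≤k = begin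
    length (f x ++ concatMap f xs)         ≡⟨ length-++ (f x) ⟩
    length (f x) + length (concatMap f xs) ≤⟨ +-mono-≤ (f≤k x) (length-concatMap-≤ f xs f≤k) ⟩
    k + length xs * k                      ∎
    where open ≤-Reasoning

  length-concatMap-const : ∀ (f : A → List B) xs {k} → (∀ {x} → x ∈ xs → length (f x) ≡ k) →
                           length (concatMap f xs) ≡ length xs * k
  length-concatMap-const f [] _ = refl
  length-concatMap-const f (x ∷ xs) f≡k =
    trans (length-++ (f x)) (cong₂ _+_ (f≡k (here refl)) (length-concatMap-const f xs (f≡k ∘ there)))

  Unique-concatMap⁺ : ∀ (f : A → List B) {xs} → Unique xs → (∀ x → Unique (f x)) →
                      (∀ {x y z} → z ∈ f x → z ∈ f y → x ≡ y) → Unique (concatMap f xs)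
  Unique-concatMap⁺ f [] _ _ = []
  Unique-concatMap⁺ f {x ∷ xs} x∷xs!@(_ ∷ xs!) f! f-disjoint =
    ++⁺ (f! x) (Unique-concatMap⁺ f xs! f! f-disjoint) disjoint
    where
      disjoint : ∀ {z} → ¬ (z ∈ f x × z ∈ concatMap f xs)
      disjoint (z∈fx , z∈rest) = Unique[x∷xs]⇒x∉xs x∷xs!
        (Any.map (f-disjoint z∈fx) (∈-concatMap⁻ f z∈rest))

size : Tree → ℕ
size leaf = 0
size (node l r) = suc (size l + size r)

∈-internalFringe⇒size≤ : ∀ {x} t → x ∈ internalFringe t → size x ≤ size t
∈-internalFringe⇒size≤ (node l r) (here refl) = ≤-refl
∈-internalFringe⇒size≤ (node l r) (there x∈) with ∈-++⁻ (internalFringe l) x∈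
... | inj₁ x∈l = m≤n⇒m≤1+n (≤-trans (∈-internalFringe⇒size≤ l x∈l) (m≤m+n (size l) (size r)))
... | inj₂ x∈r = m≤n⇒m≤1+n (≤-trans (∈-internalFringe⇒size≤ r x∈r) (m≤n+m (size r) (size l)))

node∉internalFringeˡ : ∀ l r → node l r ∉ internalFringe l
node∉internalFringeˡ l r t∈l =
  <-irrefl refl (≤-trans (s≤s (m≤m+n (size l) (size r))) (∈-internalFringe⇒size≤ l t∈l))

node∉internalFringeʳ : ∀ l r → node l r ∉ internalFringe r
node∉internalFringeʳ l r t∈r =
  <-irrefl refl (≤-trans (s≤s (m≤n+m (size r) (size l))) (∈-internalFringe⇒size≤ r t∈r))

internalFringe-⊆ : ∀ {y} t → y ∈ internalFringe t → internalFringe y ⊆ internalFringe t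
internalFringe-⊆ (node l r) (here refl) x∈y = x∈y
internalFringe-⊆ (node l r) (there y∈) x∈y with ∈-++⁻ (internalFringe l) y∈
... | inj₁ y∈l = there (∈-++⁺ˡ (internalFringe-⊆ l y∈l x∈y))
... | inj₂ y∈r = there (∈-++⁺ʳ (internalFringe l) (internalFringe-⊆ r y∈r x∈y))

compactedSize≡length : ∀ t {xs} → Unique xs → xs ⊆ internalFringe t → internalFringe t ⊆ xs →
                       compactedSize t ≡ length xs
compactedSize≡length t xs! xs⊆ ⊆xs = ≤-antisym
  (Unique∧⊆⇒length≤ (deduplicate-! (internalFringe t)) (λ x∈ → ⊆xs (∈-deduplicate⁻ _≟T_ (internalFringe t) x∈)))
  (Unique∧⊆⇒length≤ xs! (λ x∈ → ∈-deduplicate⁺ _≟T_ (xs⊆ x∈)))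

-- First occurrences in post-order

newSubtrees : List Tree → Tree → List Tree
newSubtrees S leaf = []
newSubtrees S (node l r) with node l r ∈? S
... | yes _ = []
... | no _ = newSubtrees S l ++ (newSubtrees (S ++ newSubtrees S l) r ++ node l r ∷ [])

newSubtrees-⊆ : ∀ S t → newSubtrees S t ⊆ internalFringe t
newSubtrees-⊆ S (node l r) x∈ with node l r ∈? S
... | no _ with ∈-++⁻ (newSubtrees S l) x∈
... | inj₁ x∈A = there (∈-++⁺ˡ (newSubtrees-⊆ S l x∈A))
... | inj₂ x∈B∷ʳt with ∈-++⁻ (newSubtrees (S ++ newSubtrees S l) r) x∈B∷ʳt
... | inj₁ x∈B = there (∈-++⁺ʳ (internalFringe l) (newSubtrees-⊆ _ r x∈B))
... | inj₂ (here refl) = here refl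

++-assoc-∷ʳ : ∀ (S A B : List Tree) t → S ++ (A ++ (B ++ t ∷ [])) ≡ ((S ++ A) ++ B) ++ t ∷ []
++-assoc-∷ʳ S A B t = trans (sym (++-assoc S A _)) (sym (++-assoc (S ++ A) B _))

Unique-++-newSubtrees : ∀ {S} t → Unique S → Unique (S ++ newSubtrees S t)
Unique-++-newSubtrees {S} leaf S! = subst Unique (sym (++-identityʳ S)) S!
Unique-++-newSubtrees {S} (node l r) S! with node l r ∈? S
... | yes _ = subst Unique (sym (++-identityʳ S)) S!
... | no t∉S = subst Unique (sym (++-assoc-∷ʳ S A B t))
                 (++⁺ (Unique-++-newSubtrees r (Unique-++-newSubtrees l S!)) ([] ∷ []) t∉SAB)
  where
    t = node l r
    A = newSubtrees S l
    B = newSubtrees (S ++ A) r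
    t∉SAB : ∀ {v} → ¬ (v ∈ (S ++ A) ++ B × v ∈ t ∷ [])
    t∉SAB (t∈ , here refl) with ∈-++⁻ (S ++ A) t∈
    ... | inj₂ t∈B = node∉internalFringeʳ l r (newSubtrees-⊆ (S ++ A) r t∈B)
    ... | inj₁ t∈SA with ∈-++⁻ S t∈SA
    ... | inj₁ t∈S = t∉S t∈S
    ... | inj₂ t∈A = node∉internalFringeˡ l r (newSubtrees-⊆ S l t∈A)

Closed : List Tree → Set
Closed S = ∀ {y} → y ∈ S → internalFringe y ⊆ S

mutual
  internalFringe-⊆-++-newSubtrees : ∀ {S} t → Closed S → internalFringe t ⊆ S ++ newSubtrees S t
  internalFringe-⊆-++-newSubtrees {S} (node l r) S-closed {x} x∈ with node l r ∈? S
  ... | yes t∈S = subst (x ∈_) (sym (++-identityʳ S)) (S-closed t∈S x∈)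
  ... | no _ = subst (x ∈_) (sym (++-assoc-∷ʳ S A B t)) (go x∈)
    where
      t = node l r
      A = newSubtrees S l
      B = newSubtrees (S ++ A) r
      go : x ∈ internalFringe t → x ∈ ((S ++ A) ++ B) ++ t ∷ []
      go (here refl) = ∈-++⁺ʳ ((S ++ A) ++ B) (here refl)
      go (there x∈lr) with ∈-++⁻ (internalFringe l) x∈lr
      ... | inj₁ x∈l = ∈-++⁺ˡ (∈-++⁺ˡ (internalFringe-⊆-++-newSubtrees l S-closed x∈l))
      ... | inj₂ x∈r = ∈-++⁺ˡ (internalFringe-⊆-++-newSubtrees r (Closed-++-newSubtrees l S-closed) x∈r)

  Closed-++-newSubtrees : ∀ {S} t → Closed S → Closed (S ++ newSubtrees S t)
  Closed-++-newSubtrees {S} t S-closed y∈ x∈y with ∈-++⁻ S y∈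
  ... | inj₁ y∈S = ∈-++⁺ˡ (S-closed y∈S x∈y)
  ... | inj₂ y∈new = internalFringe-⊆-++-newSubtrees t S-closed
                       (internalFringe-⊆ t (newSubtrees-⊆ S t y∈new) x∈y)

compactedSize≡length-newSubtrees : ∀ t → compactedSize t ≡ length (newSubtrees [] t)
compactedSize≡length-newSubtrees t = compactedSize≡length t
  (Unique-++-newSubtrees t []) (newSubtrees-⊆ [] t) (internalFringe-⊆-++-newSubtrees t (λ ()))

-- run b d st S: all trees produced from the stack st (top first, d+1 entries) and
-- the list S of nodes built so far, with b atoms still to be pushed. An atom is a
-- leaf or a pointer to a node of S; a merge pops two entries and pushes, and
-- records, the node made of them.
mutual
  run : (b d : ℕ) → Vec Tree (suc d) → List Tree → List Tree
  run zero    zero    (t ∷ []) S = t ∷ []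
  run zero    (suc d) st       S = merge zero d st S
  run (suc b) zero    st       S = push b zero st S
  run (suc b) (suc d) st       S = push b (suc d) st S ++ merge (suc b) d st S

  push : (b d : ℕ) → Vec Tree (suc d) → List Tree → List Tree
  push b d st S = concatMap (λ c → run b (suc d) (c ∷ st) S) (leaf ∷ S)

  merge : (b d : ℕ) → Vec Tree (suc (suc d)) → List Tree → List Tree
  merge b d (x ∷ y ∷ st) S = run b d (node y x ∷ st) (S ++ node y x ∷ [])

push⊆run : ∀ b d st S → push b d st S ⊆ run (suc b) d st S
push⊆run b zero    st S x∈ = x∈
push⊆run b (suc d) st S x∈ = ∈-++⁺ˡ x∈

merge⊆run : ∀ b d st S → merge b d st S ⊆ run b (suc d) st S
merge⊆run zero    d st S x∈ = x∈
merge⊆run (suc b) d st S x∈ = ∈-++⁺ʳ (push b (suc d) st S) x∈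

run⊆push : ∀ b d st S {c} → c ∈ leaf ∷ S → run b (suc d) (c ∷ st) S ⊆ push b d st S
run⊆push b d st S c∈ x∈ = ∈-concatMap⁺ (λ c → run b (suc d) (c ∷ st) S) (Any.map (λ { refl → x∈ }) c∈)

length-++-∷ʳ-+ : ∀ (A B : List Tree) t n →
                 length (A ++ (B ++ t ∷ [])) + n ≡ length A + suc (length B + n)
length-++-∷ʳ-+ A B t n = begin
  length (A ++ (B ++ t ∷ [])) + n         ≡⟨ cong (_+ n) (length-++ A) ⟩
  length A + length (B ++ t ∷ []) + n     ≡⟨ cong (λ k → length A + k + n) (length-++ B) ⟩
  length A + (length B + 1) + n           ≡⟨ arith (length A) (length B) n ⟩
  length A + suc (length B + n)           ∎
  where
    open ≡-Reasoning
    arith : ∀ a b n → a + (b + 1) + n ≡ a + suc (b + n)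
    arith = solve-∀

run-pushTree : ∀ t b d st S →
               run b (suc d) (t ∷ st) (S ++ newSubtrees S t) ⊆ run (suc (length (newSubtrees S t) + b)) d st S
run-pushTree leaf b d st S {x} x∈ =
  push⊆run b d st S (run⊆push b d st S (here refl)
    (subst (λ S′ → x ∈ run b (suc d) (leaf ∷ st) S′) (++-identityʳ S) x∈))
run-pushTree (node l r) b d st S {x} x∈ with node l r ∈? S
... | yes t∈S = push⊆run b d st S (run⊆push b d st S (there t∈S)
    (subst (λ S′ → x ∈ run b (suc d) (node l r ∷ st) S′) (++-identityʳ S) x∈))
... | no _ = subst (λ k → x ∈ run (suc k) d st S) (sym (length-++-∷ʳ-+ A B t b))
  (run-pushTree l (suc (length B + b)) d st S
  (run-pushTree r b (suc d) (l ∷ st) (S ++ A)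
  (merge⊆run b (suc d) (r ∷ l ∷ st) ((S ++ A) ++ B)
  (subst (λ S′ → x ∈ run b (suc d) (t ∷ st) S′) (++-assoc-∷ʳ S A B t) x∈))))
  where
    t = node l r
    A = newSubtrees S l
    B = newSubtrees (S ++ A) r

-- The bottom entry of the stack is the first atom, necessarily a leaf.
run-pushLeftmost : ∀ t b d st →
                   run b d (t ∷ st) (newSubtrees [] t) ⊆ run (length (newSubtrees [] t) + b) d (leaf ∷ st) []
run-pushLeftmost leaf b d st x∈ = x∈
run-pushLeftmost (node l r) b d st {x} x∈ with node l r ∈? []
... | no _ = subst (λ k → x ∈ run k d (leaf ∷ st) []) (sym (length-++-∷ʳ-+ A B t b))
  (run-pushLeftmost l (suc (length B + b)) d st
  (run-pushTree r b d (l ∷ st) A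
  (merge⊆run b d (r ∷ l ∷ st) (A ++ B)
  (subst (λ S′ → x ∈ run b d (t ∷ st) S′) (sym (++-assoc A B (t ∷ []))) x∈))))
  where
    t = node l r
    A = newSubtrees [] l
    B = newSubtrees A r

run-complete : ∀ t → t ∈ run (compactedSize t) 0 (leaf ∷ []) []
run-complete t = subst (λ k → t ∈ run k 0 (leaf ∷ []) [])
  (trans (+-identityʳ _) (sym (compactedSize≡length-newSubtrees t)))
  (run-pushLeftmost t 0 0 [] (here refl))

-- ballot b d counts the sequences of b atoms and the merges interleaved with them
-- that are admissible from a stack of d+1 entries.
ballot : ℕ → ℕ → ℕ
ballot zero    d       = 1
ballot (suc b) zero    = ballot b 1
ballot (suc b) (suc d) = ballot b (suc (suc d)) + ballot (suc b) d

rising : ℕ → ℕ → ℕ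
rising x zero    = 1
rising x (suc b) = x * rising (suc x) b

x!*rising≡[x+b]! : ∀ x b → x ! * rising (suc x) b ≡ (x + b) !
x!*rising≡[x+b]! x zero    = trans (*-identityʳ (x !)) (cong _! (sym (+-identityʳ x)))
x!*rising≡[x+b]! x (suc b) = begin
  x ! * (suc x * rising (suc (suc x)) b) ≡⟨ *-assoc (x !) (suc x) _ ⟨
  x ! * suc x * rising (suc (suc x)) b   ≡⟨ cong (_* rising (suc (suc x)) b) (*-comm (x !) (suc x)) ⟩
  suc x ! * rising (suc (suc x)) b       ≡⟨ x!*rising≡[x+b]! (suc x) b ⟩
  (suc x + b) !                          ≡⟨ cong _! (+-suc x b) ⟨
  (x + suc b) !                          ∎
  where open ≡-Reasoning

rising1≡! : ∀ n → rising 1 n ≡ n !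
rising1≡! n = trans (sym (+-identityʳ (rising 1 n))) (x!*rising≡[x+b]! 0 n)

-- With k nodes built and d+1 stack entries, k+d atoms have been pushed; the next
-- atom has k+1 ≤ k+d+1 possible values.
mutual
  length-run≤ : ∀ b d st S → length (run b d st S) ≤ ballot b d * rising (suc (length S + d)) b
  length-run≤ zero    zero    (t ∷ []) S = ≤-refl
  length-run≤ zero    (suc d) st       S = length-merge≤ zero d st S
  length-run≤ (suc b) zero    st       S = length-push≤ b zero st S
  length-run≤ (suc b) (suc d) st       S = begin
    length (push b (suc d) st S ++ merge (suc b) d st S)
      ≡⟨ length-++ (push b (suc d) st S) ⟩
    length (push b (suc d) st S) + length (merge (suc b) d st S)
      ≤⟨ +-mono-≤ (length-push≤ b (suc d) st S) (length-merge≤ (suc b) d st S) ⟩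
    ballot b (suc (suc d)) * R + ballot (suc b) d * R
      ≡⟨ *-distribʳ-+ R (ballot b (suc (suc d))) (ballot (suc b) d) ⟨
    ballot (suc b) (suc d) * R ∎
    where
      open ≤-Reasoning
      R = rising (suc (length S + suc d)) (suc b)

  length-push≤ : ∀ b d st S → length (push b d st S) ≤ ballot b (suc d) * rising (suc (length S + d)) (suc b)
  length-push≤ b d st S = begin
    length (push b d st S)
      ≤⟨ length-concatMap-≤ (λ c → run b (suc d) (c ∷ st) S) (leaf ∷ S)
           (λ c → length-run≤ b (suc d) (c ∷ st) S) ⟩
    suc k * (ballot b (suc d) * rising (suc (k + suc d)) b)
      ≡⟨ cong (λ m → suc k * (ballot b (suc d) * rising (suc m) b)) (+-suc k d) ⟩
    suc k * (ballot b (suc d) * R)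
      ≤⟨ *-monoˡ-≤ _ (s≤s (m≤m+n k d)) ⟩
    suc (k + d) * (ballot b (suc d) * R)
      ≡⟨ x*[y*z]≡y*[x*z] (suc (k + d)) (ballot b (suc d)) R ⟩
    ballot b (suc d) * rising (suc (k + d)) (suc b) ∎
    where
      open ≤-Reasoning
      k = length S
      R = rising (suc (suc (k + d))) b
      x*[y*z]≡y*[x*z] : ∀ x y z → x * (y * z) ≡ y * (x * z)
      x*[y*z]≡y*[x*z] = solve-∀

  length-merge≤ : ∀ b d st S → length (merge b d st S) ≤ ballot b d * rising (suc (length S + suc d)) b
  length-merge≤ b d (x ∷ y ∷ st) S = subst (λ m → length (merge b d (x ∷ y ∷ st) S) ≤ ballot b d * rising (suc m) b)
    (trans (cong (_+ d) (length-++ S)) (+-assoc (length S) 1 d))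
    (length-run≤ b d (node y x ∷ st) (S ++ node y x ∷ []))

length-run-start≤ : ∀ n → length (run n 0 (leaf ∷ []) []) ≤ ballot n 0 * n !
length-run-start≤ n = subst (λ m → length (run n 0 (leaf ∷ []) []) ≤ ballot n 0 * m)
  (rising1≡! n) (length-run≤ n 0 (leaf ∷ []) [])

_C⁻_ : ℕ → ℕ → ℕ
n C⁻ zero  = 0
n C⁻ suc k = n C k

pascal : ∀ n k → n C⁻ k + n C k ≡ suc n C k
pascal n zero    = refl
pascal n (suc k) = nCk+nC[k+1]≡[n+1]C[k+1] n k

C-symmetric : ∀ {n} k j → n ≡ k + j → n C k ≡ n C j
C-symmetric k j refl = trans (nCk≡nC[n∸k] (m≤m+n k j)) (cong ((k + j) C_) (m+n∸m≡n k j))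

ballot-binomial : ∀ b d {n} → n ≡ b + b + d → ballot b d + n C⁻ b ≡ n C b
ballot-binomial zero    d       _  = refl
ballot-binomial (suc b) d       {zero} ()
ballot-binomial (suc b) zero    {suc m} eq = begin
  ballot b 1 + suc m C b          ≡⟨ cong (ballot b 1 +_) (pascal m b) ⟨
  ballot b 1 + (m C⁻ b + m C b)   ≡⟨ +-assoc (ballot b 1) (m C⁻ b) (m C b) ⟨
  ballot b 1 + m C⁻ b + m C b     ≡⟨ cong (_+ m C b) (ballot-binomial b 1 (trans m≡ (arith b))) ⟩
  m C b + m C b                   ≡⟨ cong (m C b +_) (C-symmetric b (suc b) (trans m≡ (+-identityʳ _))) ⟩
  m C b + m C suc b               ≡⟨ nCk+nC[k+1]≡[n+1]C[k+1] m b ⟩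
  suc m C suc b                   ∎
  where
    open ≡-Reasoning
    m≡ = suc-injective eq
    arith : ∀ b → b + suc b + 0 ≡ b + b + 1
    arith = solve-∀
ballot-binomial (suc b) (suc d) {suc m} eq = begin
  ballot b (suc (suc d)) + ballot (suc b) d + suc m C b
    ≡⟨ cong (ballot b (suc (suc d)) + ballot (suc b) d +_) (pascal m b) ⟨
  ballot b (suc (suc d)) + ballot (suc b) d + (m C⁻ b + m C b)
    ≡⟨ interchange +-commutativeSemigroup (ballot b (suc (suc d))) (ballot (suc b) d) (m C⁻ b) (m C b) ⟩
  (ballot b (suc (suc d)) + m C⁻ b) + (ballot (suc b) d + m C b)
    ≡⟨ cong₂ _+_ (ballot-binomial b (suc (suc d)) (trans m≡ (arith₁ b d)))
                 (ballot-binomial (suc b) d (trans m≡ (arith₂ b d))) ⟩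
  m C b + m C suc b
    ≡⟨ nCk+nC[k+1]≡[n+1]C[k+1] m b ⟩
  suc m C suc b ∎
  where
    open ≡-Reasoning
    m≡ = suc-injective eq
    arith₁ : ∀ b d → b + suc b + suc d ≡ b + b + suc (suc d)
    arith₁ = solve-∀
    arith₂ : ∀ b d → b + suc b + suc d ≡ suc b + suc b + d
    arith₂ = solve-∀

C*k!*[n∸k]!≡n! : ∀ {n k} → k ≤ n → (n C k) * (k ! * (n ∸ k) !) ≡ n !
C*k!*[n∸k]!≡n! {n} {k} k≤n = trans (cong (_* (k ! * (n ∸ k) !)) (nCk≡n!/k![n-k]! k≤n))
  (m/n*n≡m {{k !* (n ∸ k) !≢0}} (k![n∸k]!∣n! k≤n))

C-ratio : ∀ {n} k j → n ≡ k + suc j → (n C k) * suc j ≡ (n C suc k) * suc k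
C-ratio {n} k j refl = *-cancelʳ-≡ _ _ (k ! * j !) {{k !* j !≢0}} (begin
  (n C k) * suc j * (k ! * j !)           ≡⟨ arith₁ (n C k) j (k !) (j !) ⟩
  (n C k) * (k ! * suc j !)               ≡⟨ cong (λ m → (n C k) * (k ! * m !)) (m+n∸m≡n k (suc j)) ⟨
  (n C k) * (k ! * (n ∸ k) !)             ≡⟨ C*k!*[n∸k]!≡n! (m≤m+n k (suc j)) ⟩
  n !                                     ≡⟨ C*k!*[n∸k]!≡n! k<n ⟨
  (n C suc k) * (suc k ! * (n ∸ suc k) !) ≡⟨ cong (λ m → (n C suc k) * (suc k ! * m !)) n∸suc-k≡j ⟩
  (n C suc k) * (suc k ! * j !)           ≡⟨ arith₂ (n C suc k) k (k !) (j !) ⟨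
  (n C suc k) * suc k * (k ! * j !)       ∎)
  where
    open ≡-Reasoning
    k<n : suc k ≤ n
    k<n = subst (suc k ≤_) (sym (+-suc k j)) (m≤m+n (suc k) j)
    n∸suc-k≡j : n ∸ suc k ≡ j
    n∸suc-k≡j = trans (cong (_∸ suc k) (+-suc k j)) (m+n∸m≡n (suc k) j)
    arith₁ : ∀ c j kf jf → c * suc j * (kf * jf) ≡ c * (kf * (suc j * jf))
    arith₁ = solve-∀
    arith₂ : ∀ c k kf jf → c * suc k * (kf * jf) ≡ c * ((suc k * kf) * jf)
    arith₂ = solve-∀

ballot*suc≡centralBinomial : ∀ n → ballot n 0 * suc n ≡ (2 * n) C n
ballot*suc≡centralBinomial zero    = refl
ballot*suc≡centralBinomial (suc m) = +-cancelʳ-≡ ((N C suc m) * suc m) _ _ (begin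
  ballot (suc m) 0 * suc (suc m) + (N C suc m) * suc m   ≡⟨ cong (ballot (suc m) 0 * suc (suc m) +_) ratio ⟨
  ballot (suc m) 0 * suc (suc m) + (N C m) * suc (suc m) ≡⟨ *-distribʳ-+ (suc (suc m)) (ballot (suc m) 0) (N C m) ⟨
  (ballot (suc m) 0 + N C m) * suc (suc m)               ≡⟨ cong (_* suc (suc m)) binomial ⟩
  (N C suc m) * suc (suc m)                              ≡⟨ *-suc (N C suc m) (suc m) ⟩
  N C suc m + (N C suc m) * suc m                        ∎)
  where
    open ≡-Reasoning
    N = 2 * suc m
    binomial : ballot (suc m) 0 + N C m ≡ N C suc m
    binomial = ballot-binomial (suc m) 0 (arith₁ m)
      where
        arith₁ : ∀ m → 2 * suc m ≡ suc m + suc m + 0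
        arith₁ = solve-∀
    ratio : (N C m) * suc (suc m) ≡ (N C suc m) * suc m
    ratio = C-ratio m (suc m) (arith₂ m)
      where
        arith₂ : ∀ m → 2 * suc m ≡ m + suc (suc m)
        arith₂ = solve-∀

ballot≡catalan : ∀ n → ballot n 0 ≡ catalan n
ballot≡catalan n = sym (begin
  ((2 * n) C n) / suc n      ≡⟨ cong (_/ suc n) (ballot*suc≡centralBinomial n) ⟨
  ballot n 0 * suc n / suc n ≡⟨ m*n/n≡m (ballot n 0) (suc n) ⟩
  ballot n 0                 ∎)
  where open ≡-Reasoning

spine : Tree → List Tree
spine leaf       = []
spine (node l r) = node l r ∷ spine r

spine⊆internalFringe : ∀ t → spine t ⊆ internalFringe t
spine⊆internalFringe (node l r) (here refl) = here refl
spine⊆internalFringe (node l r) (there x∈) = there (∈-++⁺ʳ (internalFringe l) (spine⊆internalFringe r x∈))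

leaf∉spine : ∀ t → leaf ∉ spine t
leaf∉spine (node l r) (there leaf∈) = leaf∉spine r leaf∈

Unique-spine : ∀ t → Unique (spine t)
Unique-spine leaf       = []
Unique-spine (node l r) = ++⁺ {xs = node l r ∷ []} ([] ∷ []) (Unique-spine r)
  λ { (here refl , t∈) → node∉internalFringeʳ l r (spine⊆internalFringe r t∈) }

extend : Tree → List Tree
extend t = map (λ x → node x t) (leaf ∷ spine t)

combs : ℕ → List Tree
combs zero    = leaf ∷ []
combs (suc k) = concatMap extend (combs k)

∈-combs⁻ : ∀ k {t} → t ∈ combs (suc k) →
           ∃ λ t′ → t′ ∈ combs k × ∃ λ x → x ∈ leaf ∷ spine t′ × t ≡ node x t′
∈-combs⁻ k t∈ with find (∈-concatMap⁻ extend {xs = combs k} t∈)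
... | t′ , t′∈ , t∈ext with ∈-map⁻ (λ x → node x t′) t∈ext
... | x , x∈ , refl = t′ , t′∈ , x , x∈ , refl

length-spine-combs : ∀ k {t} → t ∈ combs k → length (spine t) ≡ k
length-spine-combs zero    (here refl) = refl
length-spine-combs (suc k) t∈ with ∈-combs⁻ k t∈
... | t′ , t′∈ , x , _ , refl = cong suc (length-spine-combs k t′∈)

internalFringe-⊆-spineChoice : ∀ t {x} → x ∈ leaf ∷ spine t → internalFringe x ⊆ internalFringe t
internalFringe-⊆-spineChoice t (here refl) ()
internalFringe-⊆-spineChoice t (there x∈) = internalFringe-⊆ t (spine⊆internalFringe t x∈)

internalFringe-combs⊆spine : ∀ k {t} → t ∈ combs k → internalFringe t ⊆ spine t
internalFringe-combs⊆spine zero    (here refl) ()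
internalFringe-combs⊆spine (suc k) t∈ y∈ with ∈-combs⁻ k t∈
... | t′ , t′∈ , x , x∈ , refl with y∈
...   | here refl = here refl
...   | there y∈xt′ with ∈-++⁻ (internalFringe x) y∈xt′
...     | inj₁ y∈x  = there (internalFringe-combs⊆spine k t′∈ (internalFringe-⊆-spineChoice t′ x∈ y∈x))
...     | inj₂ y∈t′ = there (internalFringe-combs⊆spine k t′∈ y∈t′)

compactedSize-combs : ∀ k {t} → t ∈ combs k → compactedSize t ≡ k
compactedSize-combs k {t} t∈ = trans
  (compactedSize≡length t (Unique-spine t) (spine⊆internalFringe t) (internalFringe-combs⊆spine k t∈))
  (length-spine-combs k t∈)

Unique-combs : ∀ k → Unique (combs k)
Unique-combs zero    = [] ∷ []
Unique-combs (suc k) = Unique-concatMap⁺ extend (Unique-combs k) Unique-extend extend-disjoint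
  where
    Unique-extend : ∀ t → Unique (extend t)
    Unique-extend t = map⁺ node-injˡ (¬Any⇒All¬ (spine t) (leaf∉spine t) ∷ Unique-spine t)
    extend-disjoint : ∀ {t t′ y} → y ∈ extend t → y ∈ extend t′ → t ≡ t′
    extend-disjoint y∈ y∈′ with ∈-map⁻ (λ x → node x _) y∈ | ∈-map⁻ (λ x → node x _) y∈′
    ... | _ , _ , refl | _ , _ , eq = node-injʳ eq

length-combs : ∀ k → length (combs k) ≡ k !
length-combs zero    = refl
length-combs (suc k) = begin
  length (concatMap extend (combs k)) ≡⟨ length-concatMap-const extend (combs k) length-extend ⟩
  length (combs k) * suc k            ≡⟨ cong (_* suc k) (length-combs k) ⟩
  k ! * suc k                         ≡⟨ *-comm (k !) (suc k) ⟩
  suc k !                             ∎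
  where
    open ≡-Reasoning
    length-extend : ∀ {t} → t ∈ combs k → length (extend t) ≡ suc k
    length-extend {t} t∈ = trans (length-map _ (leaf ∷ spine t)) (cong suc (length-spine-combs k t∈))

mainTheorem6 : (n : ℕ) →
    Σ (List Tree) (λ L →
      Unique L ×
      ((t : Tree) → (t ∈ L) ⇔ (compactedSize t ≡ n)) ×
      (n ! ≤ length L) ×
      (length L ≤ catalan n * n !))
mainTheorem6 n = L , deduplicate-! candidates , (λ t → mk⇔ sound (complete t)) , lower , upper
  where
    hasSize? = λ t → compactedSize t ≟ n
    candidates = filter hasSize? (run n 0 (leaf ∷ []) [])
    L = deduplicate _≟T_ candidates
    sound : ∀ {t} → t ∈ L → compactedSize t ≡ n
    sound t∈ = proj₂ (∈-filter⁻ hasSize? {xs = run n 0 (leaf ∷ []) []} (∈-deduplicate⁻ _≟T_ candidates t∈))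
    complete : ∀ t → compactedSize t ≡ n → t ∈ L
    complete t refl = ∈-deduplicate⁺ _≟T_ (∈-filter⁺ hasSize? (run-complete t) refl)
    lower : n ! ≤ length L
    lower = subst (_≤ length L) (length-combs n)
      (Unique∧⊆⇒length≤ (Unique-combs n) (λ t∈ → complete _ (compactedSize-combs n t∈)))
    upper : length L ≤ catalan n * n !
    upper = begin
      length L                        ≤⟨ Unique∧⊆⇒length≤ (deduplicate-! candidates) (∈-deduplicate⁻ _≟T_ candidates) ⟩
      length candidates               ≤⟨ length-filter hasSize? (run n 0 (leaf ∷ []) []) ⟩
      length (run n 0 (leaf ∷ []) []) ≤⟨ length-run-start≤ n ⟩
      ballot n 0 * n !                ≡⟨ cong (_* n !) (ballot≡catalan n) ⟩
      catalan n * n !                 ∎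
      where open ≤-Reasoning
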